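{- Let $G=(V,E,\pi)$ be a finite undirected vertex-colored graph and let $\Gamma=\operatorname{Aut}(G)$. Let $\Gamma=\Gamma_1\times\cdots\times\Gamma_r$ be the finest disjoint direct decomposition of $\Gamma$. Then for any two vertices $u,v\in\operatorname{supp}(\Gamma)$, the vertices $u$ and $v$ lie in the support of the same factor $\Gamma_i$ if and only if the orbits $u^\Gamma$ and $v^\Gamma$ lie in the same connected component of the orbit graph of $G$.
   Context: An automorphism of a vertex-colored graph $G=(V,E,\pi)$ is a bijection $\varphi:V\to V$ with $\varphi(E)=E$ and $\pi(\varphi(v))=\pi(v)$ for all $v$; they form the group $\operatorname{Aut}(G)\le\operatorname{Sym}(V)$. For $\varphi\in\operatorname{Sym}(V)$, $\operatorname{supp}(\varphi)=\{v:\varphi(v)\neq v\}$, and for a group $\Gamma$, $\operatorname{supp}(\Gamma)=\bigcup_{\varphi\in\Gamma}\operatorname{supp}(\varphi)$. A disjoint direct decomposition of a permutation group $\Gamma$ is an expression $\Gamma=\Gamma_1\times\cdots\times\Gamma_r$ as an (internal) direct product of subgroups $\Gamma_i$ with pairwise disjoint supports; it is finest if no factor $\Gamma_i$ admits a non-trivial disjoint direct decomposition. Two distinct orbits $\Delta,\Delta'$ of $\operatorname{Aut}(G)$ are homogeneously connected if either every vertex of $\Delta$ is adjacent to every vertex of $\Delta'$, or no edge has one endpoint in $\Delta$ and the other in $\Delta'$. The orbit graph of $G$ has as vertex set the set of orbits of $\operatorname{Aut}(G)$ on $V$, and two distinct orbits are adjacent iff they are not homogeneously connected in $G$. -}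

module Defs where

open import Level using (Level; _⊔_; 0ℓ) renaming (suc to lsuc)
open import Data.Nat using (ℕ; zero; suc)
open import Data.Bool using (Bool; true; false)
open import Data.Fin using (Fin; zero; suc)
open import Data.Fin.Permutation using (Permutation′; _⟨$⟩ʳ_; _≈_; id; flip; _∘ₚ_)
open import Data.Product using (Σ; ∃; ∃-syntax; _×_; _,_)
open import Data.Sum using (_⊎_)
open import Relation.Nullary using (¬_)
open import Relation.Binary.PropositionalEquality using (_≡_; _≢_)
open import Relation.Binary.Construct.Closure.ReflexiveTransitive using (Star)

record Graph (n : ℕ) : Set where
  field
    adj      : Fin n → Fin n → Bool
    adj-sym  : ∀ u v → adj u v ≡ adj v u
    adj-irr  : ∀ v → adj v v ≡ false
    colour   : Fin n → ℕ
open Graph public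

Perm : ℕ → Set
Perm = Permutation′

PermSet : ℕ → Set₁
PermSet n = Perm n → Set

module _ {n : ℕ} where

  IsAut : Graph n → PermSet n
  IsAut G φ = (∀ u v → adj G (φ ⟨$⟩ʳ u) (φ ⟨$⟩ʳ v) ≡ adj G u v)
            × (∀ v → colour G (φ ⟨$⟩ʳ v) ≡ colour G v)

  record IsSubgroup (H : PermSet n) : Set where
    field
      resp  : ∀ {σ τ} → σ ≈ τ → H σ → H τ
      has-id : H id
      closed-∘ : ∀ {σ τ} → H σ → H τ → H (σ ∘ₚ τ)
      closed-⁻¹ : ∀ {σ} → H σ → H (flip σ)

  _⊆_ : PermSet n → PermSet n → Set
  H ⊆ K = ∀ {σ} → H σ → K σ

  InSuppPerm : Perm n → Fin n → Set
  InSuppPerm φ v = φ ⟨$⟩ʳ v ≢ v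

  InSupp : PermSet n → Fin n → Set
  InSupp H v = ∃[ φ ] (H φ × InSuppPerm φ v)

  prod : ∀ {r} → (Fin r → Perm n) → Perm n
  prod {zero}  f = id
  prod {suc r} f = f zero ∘ₚ prod (λ i → f (suc i))

  -- H = H₁ × ⋯ × H_r as an internal direct product of subgroups with
  -- pairwise disjoint supports: the multiplication map
  -- H₁ × ⋯ × H_r → H, (γᵢ) ↦ ∏ γᵢ, is well defined (Hᵢ ≤ H),
  -- surjective and injective.
  record IsDisjointDirectDecomposition (H : PermSet n) {r : ℕ}
           (Hs : Fin r → PermSet n) : Set₁ where
    field
      factor-subgroup : ∀ i → IsSubgroup (Hs i)
      factor-⊆        : ∀ i → Hs i ⊆ H
      disjoint-supp   : ∀ i j → i ≢ j → ∀ v → InSupp (Hs i) v → ¬ InSupp (Hs j) v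
      generate        : ∀ {γ} → H γ →
                        ∃[ f ] ((∀ i → Hs i (f i)) × prod f ≈ γ)
      unique          : ∀ f g → (∀ i → Hs i (f i)) → (∀ i → Hs i (g i)) →
                        prod f ≈ prod g → ∀ i → f i ≈ g i

  Nontrivial : PermSet n → Set
  Nontrivial H = ∃[ σ ] (H σ × ¬ (σ ≈ id))

  HasNontrivialDDD : PermSet n → Set₁
  HasNontrivialDDD H =
    Σ ℕ λ s → Σ (Fin s → PermSet n) λ Ks →
      IsDisjointDirectDecomposition H Ks ×
      ∃[ i ] ∃[ j ] (i ≢ j × Nontrivial (Ks i) × Nontrivial (Ks j))

  IsFinestDDD : PermSet n → ∀ {r} → (Fin r → PermSet n) → Set₁
  IsFinestDDD H Hs = IsDisjointDirectDecomposition H Hs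
                   × (∀ i → ¬ HasNontrivialDDD (Hs i))

  InOrbit : Graph n → Fin n → Fin n → Set
  InOrbit G u x = ∃[ φ ] (IsAut G φ × φ ⟨$⟩ʳ u ≡ x)

  HomConnected : Graph n → Fin n → Fin n → Set
  HomConnected G u v =
      (∀ x y → InOrbit G u x → InOrbit G v y → adj G x y ≡ true)
    ⊎ (∀ x y → InOrbit G u x → InOrbit G v y → adj G x y ≡ false)

  OrbitAdj : Graph n → Fin n → Fin n → Set
  OrbitAdj G u v = ¬ InOrbit G u v × ¬ HomConnected G u v

  -- One step in the orbit graph, on representatives: either the same
  -- orbit (change of representative) or adjacent orbits.
  OrbitStep : Graph n → Fin n → Fin n → Set
  OrbitStep G u v = InOrbit G u v ⊎ OrbitAdj G u v

  SameOrbitComponent : Graph n → Fin n → Fin n → Set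
  SameOrbitComponent G = Star (OrbitStep G)

{-# OPTIONS --safe #-}
-- Automorphisms act factor by factor: on the support of Γᵢ every automorphism
-- agrees with an element of Γᵢ, which fixes the supports of all other factors.
-- Hence orbits meeting the supports of different factors (or fixed points) are
-- homogeneously connected, so every edge of the orbit graph stays inside the
-- support of one factor. Conversely, if u and v lie in the support of Γᵢ but in
-- different components, let C be the component of u. It is Aut(G)-invariant and
-- homogeneously connected to its complement, so restricting an automorphism to C,
-- or to its complement, again gives an automorphism. Splitting every element of
-- Γᵢ this way decomposes Γᵢ non-trivially, contradicting finest-ness. All relations
-- involved are decidable by finite search, so this contradiction yields a path.
module Submission where

open import Defs
open import Level using (0ℓ)
open import Data.Nat using (ℕ; zero; suc; _<_)
open import Data.Nat.Induction using (<-wellFounded)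
open import Induction.WellFounded using (Acc; acc)
open import Data.Bool using (true; false)
import Data.Bool.Properties as Bool
import Data.Nat.Properties as ℕ
open import Data.Fin using (Fin; zero; suc; _≟_; punchIn)
open import Data.Fin.Properties using (any?; all?; ¬∀⟶∃¬; suc-injective)
open import Data.Fin.Subset using (Subset; _∉_; _-_; ⁅_⁆; ∣_∣) renaming (∁ to ∁ₛ)
open import Data.Fin.Subset.Properties
  using (_∈?_; x∈⁅x⁆; x∈⁅y⁆⇒x≡y; x∈p⇒x∉∁p; x∉∁p⇒x∈p; x∈p∧x≢y⇒x∈p-y; p─q⊆p; x∈p⇒∣p-x∣<∣p∣)
open import Data.Fin.Permutation
  using (Permutation′; _⟨$⟩ʳ_; _⟨$⟩ˡ_; _≈_; id; flip; permutation; inverseˡ; inverseʳ;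
         insert; remove; insert-remove)
open import Data.Product using (∃; ∃-syntax; _×_; _,_; proj₁; proj₂)
open import Data.Sum using (_⊎_; inj₁; inj₂)
open import Function using (_∘_)
open import Function.Bundles using (_⇔_; mk⇔)
open import Relation.Nullary using (¬_; Dec; yes; no; contradiction)
open import Relation.Nullary.Decidable using (_×-dec_; _⊎-dec_; _→-dec_; ¬?; decidable-stable)
open import Relation.Unary using (Pred; Decidable; ∁)
open import Relation.Unary.Properties using (∁?)
open import Relation.Binary using (Rel)
open import Relation.Binary.PropositionalEquality
  using (_≡_; _≢_; refl; sym; trans; cong; cong₂; subst; module ≡-Reasoning)
open import Relation.Binary.Construct.Closure.ReflexiveTransitive using (Star; ε; _◅_; _◅◅_)

-- Finite search

module Reachability {n : ℕ} {R : Rel (Fin n) 0ℓ} (R? : ∀ x y → Dec (R x y)) (a : Fin n) where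

  -- q is the set of vertices not yet found to be reachable from a.
  Explored : Subset n → Set
  Explored q = a ∉ q × (∀ {x} → x ∉ q → Star R a x)

  Saturated : Subset n → Set
  Saturated q = ∀ {x y} → x ∉ q → R x y → y ∉ q

  private
    explored-remove : ∀ {q x y} → Explored q → x ∉ q → R x y → Explored (q - y)
    explored-remove {q} {y = y} (a∉q , reach) x∉q xRy =
      (λ a∈q-y → a∉q (p─q⊆p q ⁅ y ⁆ a∈q-y)) , reach′
      where
      reach′ : ∀ {z} → z ∉ q - y → Star R a z
      reach′ {z} z∉q-y with z ≟ y
      ... | yes refl = reach x∉q ◅◅ (xRy ◅ ε)
      ... | no z≢y   = reach (λ z∈q → z∉q-y (x∈p∧x≢y⇒x∈p-y z∈q z≢y))

    saturate : ∀ q → Acc _<_ ∣ q ∣ → Explored q → ∃[ q′ ] (Explored q′ × Saturated q′)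
    saturate q (acc smaller) e
      with any? (λ x → any? (λ y → ¬? (x ∈? q) ×-dec R? x y ×-dec y ∈? q))
    ... | yes (x , y , x∉q , xRy , y∈q) =
      saturate (q - y) (smaller (x∈p⇒∣p-x∣<∣p∣ y∈q)) (explored-remove e x∉q xRy)
    ... | no no-edge = q , e , λ x∉q xRy y∈q → no-edge (_ , _ , x∉q , xRy , y∈q)

    saturated-star : ∀ {q x y} → Saturated q → x ∉ q → Star R x y → y ∉ q
    saturated-star s x∉q ε          = x∉q
    saturated-star s x∉q (xRz ◅ zy) = saturated-star s (s x∉q xRz) zy

    start : Explored (∁ₛ ⁅ a ⁆)
    start = x∈p⇒x∉∁p (x∈⁅x⁆ a) , λ x∉ → subst (Star R a) (sym (x∈⁅y⁆⇒x≡y a (x∉∁p⇒x∈p x∉))) ε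

  star? : ∀ b → Dec (Star R a b)
  star? b with saturate (∁ₛ ⁅ a ⁆) (<-wellFounded _) start
  ... | q , (a∉q , reach) , s with b ∈? q
  ...   | yes b∈q = no (λ path → saturated-star s a∉q path b∈q)
  ...   | no b∉q  = yes (reach b∉q)

Respects≈ : ∀ {n} → PermSet n → Set
Respects≈ P = ∀ {σ τ} → σ ≈ τ → P σ → P τ

insert-cong : ∀ {m} (i j : Fin (suc m)) {π ρ : Permutation′ m} → π ≈ ρ → insert i j π ≈ insert i j ρ
insert-cong i j π≈ρ k with i ≟ k
... | yes _ = refl
... | no _  = cong (punchIn j) (π≈ρ _)

anyPermutation? : ∀ {n} {P : PermSet n} → Respects≈ P → (∀ σ → Dec (P σ)) → Dec (∃ P)
anyPermutation? {zero} resp P? with P? id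
... | yes p = yes (id , p)
... | no ¬p = no λ (σ , q) → ¬p (resp (λ ()) q)
anyPermutation? {suc m} {P} resp P?
  with any? (λ j → anyPermutation? (resp ∘ insert-cong zero j) (P? ∘ insert zero j))
... | yes (j , π , p) = yes (insert zero j π , p)
... | no ¬p = no λ (σ , q) →
  ¬p (σ ⟨$⟩ʳ zero , remove zero σ , resp (λ k → sym (insert-remove zero σ k)) q)

module _ {n : ℕ} (G : Graph n) where

  isAut-resp : Respects≈ (IsAut G)
  isAut-resp σ≈τ (adj-pres , colour-pres) =
    (λ u v → trans (cong₂ (adj G) (sym (σ≈τ u)) (sym (σ≈τ v))) (adj-pres u v)) ,
    (λ v → trans (cong (colour G) (sym (σ≈τ v))) (colour-pres v))

  isAut-id : IsAut G id
  isAut-id = (λ _ _ → refl) , (λ _ → refl)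

  isAut? : ∀ φ → Dec (IsAut G φ)
  isAut? φ = all? (λ u → all? (λ v → adj G (φ ⟨$⟩ʳ u) (φ ⟨$⟩ʳ v) Bool.≟ adj G u v))
       ×-dec all? (λ v → colour G (φ ⟨$⟩ʳ v) ℕ.≟ colour G v)

  inOrbit? : ∀ u x → Dec (InOrbit G u x)
  inOrbit? u x = anyPermutation?
    (λ {σ} {τ} σ≈τ (aut , σu≡x) → isAut-resp {σ} {τ} σ≈τ aut , trans (sym (σ≈τ u)) σu≡x)
    (λ φ → isAut? φ ×-dec φ ⟨$⟩ʳ u ≟ x)

  inSuppAut? : ∀ v → Dec (InSupp (IsAut G) v)
  inSuppAut? v = anyPermutation?
    (λ {σ} {τ} σ≈τ (aut , σv≢v) → isAut-resp {σ} {τ} σ≈τ aut , σv≢v ∘ trans (σ≈τ v))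
    (λ φ → isAut? φ ×-dec ¬? (φ ⟨$⟩ʳ v ≟ v))

  homConnected? : ∀ u v → Dec (HomConnected G u v)
  homConnected? u v = allPairs? true ⊎-dec allPairs? false
    where
    allPairs? : ∀ b → Dec (∀ x y → InOrbit G u x → InOrbit G v y → adj G x y ≡ b)
    allPairs? b = all? λ x → all? λ y → inOrbit? u x →-dec inOrbit? v y →-dec adj G x y Bool.≟ b

  orbitStep? : ∀ u v → Dec (OrbitStep G u v)
  orbitStep? u v = inOrbit? u v ⊎-dec (¬? (inOrbit? u v) ×-dec ¬? (homConnected? u v))

  orbitStep⊎homConnected : ∀ u v → OrbitStep G u v ⊎ HomConnected G u v
  orbitStep⊎homConnected u v with inOrbit? u v | homConnected? u v
  ... | yes u~v | _         = inj₁ (inj₁ u~v)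
  ... | no _    | yes hom   = inj₂ hom
  ... | no u≁v  | no ¬hom   = inj₁ (inj₂ (u≁v , ¬hom))

  inOrbit-refl : ∀ u → InOrbit G u u
  inOrbit-refl u = id , isAut-id , refl

  Homogeneous : Fin n → Fin n → Set
  Homogeneous x y = ∀ {a b} → InOrbit G x a → InOrbit G y b → adj G a b ≡ adj G x y

  homogeneous-sym : ∀ {x y} → Homogeneous x y → Homogeneous y x
  homogeneous-sym {x} {y} hom {a} {b} y~a x~b =
    trans (adj-sym G a b) (trans (hom x~b y~a) (adj-sym G x y))

  homogeneous⇒homConnected : ∀ {x y} → Homogeneous x y → HomConnected G x y
  homogeneous⇒homConnected {x} {y} hom with adj G x y
  ... | true  = inj₁ λ _ _ → hom
  ... | false = inj₂ λ _ _ → hom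

  homConnected⇒homogeneous : ∀ {x y} → HomConnected G x y → Homogeneous x y
  homConnected⇒homogeneous {x} {y} (inj₁ all-adj) x~a y~b =
    trans (all-adj _ _ x~a y~b) (sym (all-adj x y (inOrbit-refl x) (inOrbit-refl y)))
  homConnected⇒homogeneous {x} {y} (inj₂ no-adj) x~a y~b =
    trans (no-adj _ _ x~a y~b) (sym (no-adj x y (inOrbit-refl x) (inOrbit-refl y)))

  fixed⇒homogeneous : ∀ {x y} → ¬ InSupp (IsAut G) y → Homogeneous x y
  fixed⇒homogeneous {x} {y} y-fixed (φ , φ-aut , refl) (ψ , ψ-aut , refl) =
    trans (cong (adj G (φ ⟨$⟩ʳ x)) (trans (fixes {ψ} ψ-aut) (sym (fixes {φ} φ-aut)))) (proj₁ φ-aut x y)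
    where
    fixes : ∀ {χ} → IsAut G χ → χ ⟨$⟩ʳ y ≡ y
    fixes {χ} χ-aut with χ ⟨$⟩ʳ y ≟ y
    ... | yes χy≡y = χy≡y
    ... | no χy≢y  = contradiction (χ , χ-aut , χy≢y) y-fixed

module _ {n : ℕ} where

  supp-image : ∀ {K : PermSet n} → IsSubgroup K → ∀ {σ x} → K σ → InSupp K x → InSupp K (σ ⟨$⟩ʳ x)
  supp-image K-sub {σ} {x} σ∈K x∈supp with σ ⟨$⟩ʳ x ≟ x
  ... | yes σx≡x = subst (InSupp _) (sym σx≡x) x∈supp
  ... | no σx≢x  = flip σ , IsSubgroup.closed-⁻¹ K-sub σ∈K ,
                   λ σ⁻¹σx≡σx → σx≢x (sym (trans (sym (inverseˡ σ)) σ⁻¹σx≡σx))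

  prod-fixes : ∀ {r} (f : Fin r → Perm n) {w} → (∀ j → f j ⟨$⟩ʳ w ≡ w) → prod f ⟨$⟩ʳ w ≡ w
  prod-fixes {zero}  f fixes = refl
  prod-fixes {suc r} f fixes rewrite fixes zero = prod-fixes (f ∘ suc) (fixes ∘ suc)

  prod-single : ∀ {r} (f : Fin r → Perm n) i {w} →
    (∀ j → j ≢ i → f j ⟨$⟩ʳ w ≡ w) → (∀ j → j ≢ i → f j ⟨$⟩ʳ (f i ⟨$⟩ʳ w) ≡ f i ⟨$⟩ʳ w) →
    prod f ⟨$⟩ʳ w ≡ f i ⟨$⟩ʳ w
  prod-single {suc r} f zero    fix-w fix-fw = prod-fixes (f ∘ suc) (λ j → fix-fw (suc j) λ ())
  prod-single {suc r} f (suc i) fix-w fix-fw rewrite fix-w zero (λ ()) =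
    prod-single (f ∘ suc) i (λ j j≢i → fix-w (suc j) (j≢i ∘ suc-injective))
                            (λ j j≢i → fix-fw (suc j) (j≢i ∘ suc-injective))

  IsRestriction : Pred (Fin n) 0ℓ → Perm n → Perm n → Set
  IsRestriction D γ ρ = (∀ {x} → D x → ρ ⟨$⟩ʳ x ≡ γ ⟨$⟩ʳ x) × (∀ {x} → ¬ D x → ρ ⟨$⟩ʳ x ≡ x)

  restriction-supp : ∀ {D γ ρ x} → IsRestriction D γ ρ → ρ ⟨$⟩ʳ x ≢ x → γ ⟨$⟩ʳ x ≢ x
  restriction-supp (on-D , off-D) ρx≢x γx≡x =
    ρx≢x (off-D λ x∈D → ρx≢x (trans (on-D x∈D) γx≡x))

module Restriction {n : ℕ} {D : Pred (Fin n) 0ℓ} (D? : Decidable D) (γ : Perm n)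
                   (γ-stable : ∀ {x} → D x → D (γ ⟨$⟩ʳ x))
                   (γ⁻¹-stable : ∀ {x} → D x → D (γ ⟨$⟩ˡ x)) where

  private
    on-D : (Fin n → Fin n) → Fin n → Fin n
    on-D f x with D? x
    ... | yes _ = f x
    ... | no _  = x

    on-D-in : ∀ f {x} → D x → on-D f x ≡ f x
    on-D-in f {x} x∈D with D? x
    ... | yes _   = refl
    ... | no x∉D = contradiction x∈D x∉D

    on-D-out : ∀ f {x} → ¬ D x → on-D f x ≡ x
    on-D-out f {x} x∉D with D? x
    ... | yes x∈D = contradiction x∈D x∉D
    ... | no _    = refl

    on-D-inverse : ∀ (f g : Fin n → Fin n) → (∀ {x} → D x → D (g x)) → (∀ {x} → f (g x) ≡ x) →
                   ∀ x → on-D f (on-D g x) ≡ x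
    on-D-inverse f g g-stable f∘g≡id x with D? x
    ... | yes x∈D = trans (on-D-in f (g-stable x∈D)) f∘g≡id
    ... | no x∉D  = on-D-out f x∉D

  restrict : Perm n
  restrict = permutation (on-D (γ ⟨$⟩ʳ_)) (on-D (γ ⟨$⟩ˡ_))
    (on-D-inverse _ _ γ⁻¹-stable (inverseʳ γ)) (on-D-inverse _ _ γ-stable (inverseˡ γ))

  restrict-isRestriction : IsRestriction D γ restrict
  restrict-isRestriction = on-D-in _ , on-D-out _

-- Splitting a permutation group along an invariant set

module _ {n : ℕ} where

  SupportedIn : PermSet n → Pred (Fin n) 0ℓ → PermSet n
  SupportedIn K D σ = K σ × (∀ {x} → ¬ D x → σ ⟨$⟩ʳ x ≡ x)

  supportedIn-subgroup : ∀ {K D} → IsSubgroup K → IsSubgroup (SupportedIn K D)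
  supportedIn-subgroup {K} {D} K-sub = record
    { resp      = λ {σ} {τ} σ≈τ (σ∈K , σ-fix) → resp σ≈τ σ∈K , λ x∉D → trans (sym (σ≈τ _)) (σ-fix x∉D)
    ; has-id    = has-id , λ _ → refl
    ; closed-∘  = λ {σ} {τ} (σ∈K , σ-fix) (τ∈K , τ-fix) →
                    closed-∘ σ∈K τ∈K , λ x∉D → trans (cong (τ ⟨$⟩ʳ_) (σ-fix x∉D)) (τ-fix x∉D)
    ; closed-⁻¹ = λ {σ} (σ∈K , σ-fix) →
                    closed-⁻¹ σ∈K , λ x∉D → trans (cong (σ ⟨$⟩ˡ_) (sym (σ-fix x∉D))) (inverseˡ σ)
    }
    where open IsSubgroup K-sub

  supportedIn-supp : ∀ {K D x} → InSupp (SupportedIn K D) x → ¬ ¬ D x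
  supportedIn-supp (σ , (_ , σ-fix) , σx≢x) x∉D = σx≢x (σ-fix x∉D)

  pair : Perm n → Perm n → Fin 2 → Perm n
  pair σ τ zero       = σ
  pair σ τ (suc zero) = τ

module Splitting {n : ℕ} {K : PermSet n} (K-sub : IsSubgroup K) {D : Pred (Fin n) 0ℓ} (D? : Decidable D)
                 (K-stable : ∀ {σ} → K σ → ∀ {x} → D x → D (σ ⟨$⟩ʳ x))
                 (K-restrict : ∀ {σ ρ} → K σ → IsRestriction D σ ρ → K ρ)
                 (K-restrict∁ : ∀ {σ ρ} → K σ → IsRestriction (∁ D) σ ρ → K ρ) where

  open IsSubgroup K-sub

  ∁-stable : ∀ {σ} → K σ → ∀ {x} → ¬ D x → ¬ D (σ ⟨$⟩ʳ x)
  ∁-stable {σ} σ∈K x∉D σx∈D = x∉D (subst D (inverseˡ σ) (K-stable (closed-⁻¹ σ∈K) σx∈D))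

  module _ {σ} (σ∈K : K σ) where

    private
      module OnD  = Restriction D? σ (K-stable σ∈K) (K-stable (closed-⁻¹ σ∈K))
      module On∁D = Restriction (∁? D?) σ (∁-stable σ∈K) (∁-stable (closed-⁻¹ σ∈K))

    restrict : Perm n
    restrict = OnD.restrict

    restrict-isRestriction : IsRestriction D σ restrict
    restrict-isRestriction = OnD.restrict-isRestriction

    restrict∁ : Perm n
    restrict∁ = On∁D.restrict

    restrict∁-isRestriction : IsRestriction (∁ D) σ restrict∁
    restrict∁-isRestriction = On∁D.restrict-isRestriction

    restrict-supportedIn : SupportedIn K D restrict
    restrict-supportedIn = K-restrict σ∈K restrict-isRestriction , proj₂ restrict-isRestriction

    restrict∁-supportedIn : SupportedIn K (∁ D) restrict∁
    restrict∁-supportedIn = K-restrict∁ σ∈K restrict∁-isRestriction , proj₂ restrict∁-isRestriction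

    restrict-moves : ∀ {x} → D x → σ ⟨$⟩ʳ x ≢ x → ¬ restrict ≈ id
    restrict-moves x∈D σx≢x restrict≈id =
      σx≢x (trans (sym (proj₁ restrict-isRestriction x∈D)) (restrict≈id _))

    restrict∁-moves : ∀ {x} → ¬ D x → σ ⟨$⟩ʳ x ≢ x → ¬ restrict∁ ≈ id
    restrict∁-moves x∉D σx≢x restrict∁≈id =
      σx≢x (trans (sym (proj₁ restrict∁-isRestriction x∉D)) (restrict∁≈id _))

  Factors : Fin 2 → PermSet n
  Factors zero       = SupportedIn K D
  Factors (suc zero) = SupportedIn K (∁ D)

  module _ {f : Fin 2 → Perm n} (f∈Factors : ∀ i → Factors i (f i)) where

    prod-on-D : ∀ {x} → D x → prod f ⟨$⟩ʳ x ≡ f zero ⟨$⟩ʳ x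
    prod-on-D x∈D = proj₂ (f∈Factors (suc zero)) λ f₀x∉D → f₀x∉D (K-stable (proj₁ (f∈Factors zero)) x∈D)

    prod-off-D : ∀ {x} → ¬ D x → prod f ⟨$⟩ʳ x ≡ f (suc zero) ⟨$⟩ʳ x
    prod-off-D x∉D = cong (f (suc zero) ⟨$⟩ʳ_) (proj₂ (f∈Factors zero) x∉D)

  restrictions∈Factors : ∀ {σ} (σ∈K : K σ) i → Factors i (pair (restrict σ∈K) (restrict∁ σ∈K) i)
  restrictions∈Factors σ∈K zero       = restrict-supportedIn σ∈K
  restrictions∈Factors σ∈K (suc zero) = restrict∁-supportedIn σ∈K

  prod-restrictions : ∀ {σ} (σ∈K : K σ) → prod (pair (restrict σ∈K) (restrict∁ σ∈K)) ≈ σ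
  prod-restrictions {σ} σ∈K x = by-cases (D? x)
    where
    by-cases : Dec (D x) → prod (pair (restrict σ∈K) (restrict∁ σ∈K)) ⟨$⟩ʳ x ≡ σ ⟨$⟩ʳ x
    by-cases (yes x∈D) = trans (prod-on-D (restrictions∈Factors σ∈K) x∈D)
                               (proj₁ (restrict-isRestriction σ∈K) x∈D)
    by-cases (no x∉D)  = trans (prod-off-D (restrictions∈Factors σ∈K) x∉D)
                               (proj₁ (restrict∁-isRestriction σ∈K) x∉D)

  factors-decomposition : IsDisjointDirectDecomposition K Factors
  factors-decomposition = record
    { factor-subgroup = λ { zero → supportedIn-subgroup K-sub ; (suc zero) → supportedIn-subgroup K-sub }
    ; factor-⊆        = λ { zero → proj₁ ; (suc zero) → proj₁ }
    ; disjoint-supp   = disjoint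
    ; generate        = λ σ∈K → pair (restrict σ∈K) (restrict∁ σ∈K) ,
                                restrictions∈Factors σ∈K , prod-restrictions σ∈K
    ; unique          = unique
    }
    where
    disjoint : ∀ i j → i ≢ j → ∀ x → InSupp (Factors i) x → ¬ InSupp (Factors j) x
    disjoint zero       zero       i≢j = contradiction refl i≢j
    disjoint zero       (suc zero) _   x x∈₀ x∈₁ = supportedIn-supp x∈₁ (supportedIn-supp x∈₀)
    disjoint (suc zero) zero       _   x x∈₁ x∈₀ = supportedIn-supp x∈₁ (supportedIn-supp x∈₀)
    disjoint (suc zero) (suc zero) i≢j = contradiction refl i≢j

    unique : ∀ f g → (∀ i → Factors i (f i)) → (∀ i → Factors i (g i)) → prod f ≈ prod g → ∀ i → f i ≈ g i
    unique f g f∈ g∈ f≈g i x with D? x | i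
    ... | yes x∈D | zero     = trans (sym (prod-on-D f∈ x∈D)) (trans (f≈g x) (prod-on-D g∈ x∈D))
    ... | yes x∈D | suc zero = trans (proj₂ (f∈ (suc zero)) (λ x∉D → x∉D x∈D))
                                     (sym (proj₂ (g∈ (suc zero)) (λ x∉D → x∉D x∈D)))
    ... | no x∉D  | zero     = trans (proj₂ (f∈ zero) x∉D) (sym (proj₂ (g∈ zero) x∉D))
    ... | no x∉D  | suc zero = trans (sym (prod-off-D f∈ x∉D)) (trans (f≈g x) (prod-off-D g∈ x∉D))

  splitting-nontrivial : ∀ {σ τ u v} → K σ → K τ → D u → ¬ D v → σ ⟨$⟩ʳ u ≢ u → τ ⟨$⟩ʳ v ≢ v →
                         HasNontrivialDDD K
  splitting-nontrivial σ∈K τ∈K u∈D v∉D σu≢u τv≢v =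
    2 , Factors , factors-decomposition , zero , suc zero , (λ ()) ,
    (restrict σ∈K , restrict-supportedIn σ∈K , restrict-moves σ∈K u∈D σu≢u) ,
    (restrict∁ τ∈K , restrict∁-supportedIn τ∈K , restrict∁-moves τ∈K v∉D τv≢v)

module Decomposition {n : ℕ} {H : PermSet n} {r : ℕ} {Hs : Fin r → PermSet n}
                     (dd : IsDisjointDirectDecomposition H Hs) where

  open IsDisjointDirectDecomposition dd

  fixes-other-supp : ∀ {i j x g} → j ≢ i → InSupp (Hs i) x → Hs j g → g ⟨$⟩ʳ x ≡ x
  fixes-other-supp {i} {j} {x} {g} j≢i x∈supp g∈Hsⱼ with g ⟨$⟩ʳ x ≟ x
  ... | yes gx≡x = gx≡x
  ... | no gx≢x  = contradiction (g , g∈Hsⱼ , gx≢x) (disjoint-supp i j (j≢i ∘ sym) x x∈supp)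

  prod-on-supp : ∀ {f} → (∀ j → Hs j (f j)) → ∀ {i w} → InSupp (Hs i) w → prod f ⟨$⟩ʳ w ≡ f i ⟨$⟩ʳ w
  prod-on-supp {f} f∈Hs {i} {w} w∈supp =
    prod-single _ i (λ j j≢i → fixes-other-supp j≢i w∈supp (f∈Hs j))
                    (λ j j≢i → fixes-other-supp j≢i fᵢw∈supp (f∈Hs j))
    where
    fᵢw∈supp : InSupp (Hs i) (f i ⟨$⟩ʳ w)
    fᵢw∈supp = supp-image (factor-subgroup i) (f∈Hs i) w∈supp

  acts-as-factor : ∀ {φ i x} → H φ → InSupp (Hs i) x → ∃[ g ] (Hs i g × φ ⟨$⟩ʳ x ≡ g ⟨$⟩ʳ x)
  acts-as-factor {i = i} φ∈H x∈supp with generate φ∈H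
  ... | f , f∈Hs , prod≈φ = f i , f∈Hs i , trans (sym (prod≈φ _)) (prod-on-supp f∈Hs x∈supp)

  supp-image-factor : ∀ {φ i x} → H φ → InSupp (Hs i) x → InSupp (Hs i) (φ ⟨$⟩ʳ x)
  supp-image-factor {i = i} φ∈H x∈supp with acts-as-factor φ∈H x∈supp
  ... | g , g∈Hsᵢ , φx≡gx = subst (InSupp (Hs i)) (sym φx≡gx) (supp-image (factor-subgroup i) g∈Hsᵢ x∈supp)

  supp-factor : ∀ {x} → InSupp H x → ∃[ i ] InSupp (Hs i) x
  supp-factor {x} (φ , φ∈H , φx≢x) with generate φ∈H
  ... | f , f∈Hs , prod≈φ with all? (λ j → f j ⟨$⟩ʳ x ≟ x)
  ...   | yes all-fix = contradiction (trans (sym (prod≈φ x)) (prod-fixes f all-fix)) φx≢x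
  ...   | no ¬all-fix with ¬∀⟶∃¬ r _ (λ j → f j ⟨$⟩ʳ x ≟ x) ¬all-fix
  ...     | j , fⱼx≢x = j , f j , f∈Hs j , fⱼx≢x

  supp⊆⇒factor : ∀ {i ρ} → H ρ → (∀ {w} → ρ ⟨$⟩ʳ w ≢ w → InSupp (Hs i) w) → Hs i ρ
  supp⊆⇒factor {i} {ρ} ρ∈H supp⊆ with generate ρ∈H
  ... | f , f∈Hs , prod≈ρ = IsSubgroup.resp (factor-subgroup i) fᵢ≈ρ (f∈Hs i)
    where
    fᵢ≈ρ : f i ≈ ρ
    fᵢ≈ρ w with f i ⟨$⟩ʳ w ≟ w | ρ ⟨$⟩ʳ w ≟ w
    ... | no fᵢw≢w | _        = trans (sym (prod-on-supp f∈Hs (f i , f∈Hs i , fᵢw≢w))) (prod≈ρ w)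
    ... | yes fᵢw≡w | yes ρw≡w = trans fᵢw≡w (sym ρw≡w)
    ... | yes _     | no ρw≢w  = trans (sym (prod-on-supp f∈Hs (supp⊆ ρw≢w))) (prod≈ρ w)

-- The orbit graph and the factors of Aut(G)

module _ {n : ℕ} (G : Graph n) where

  restriction-isAut : ∀ {D} → Decidable D → (∀ {x y} → D x → ¬ D y → Homogeneous G x y) →
                      ∀ {γ ρ} → IsAut G γ → IsRestriction D γ ρ → IsAut G ρ
  restriction-isAut {D} D? separated {γ} {ρ} γ-aut@(adj-pres , colour-pres) (on-D , off-D) =
    (λ u v → adj-cases (D? u) (D? v)) , λ v → colour-cases (D? v)
    where
    adj-cases : ∀ {u v} → Dec (D u) → Dec (D v) → adj G (ρ ⟨$⟩ʳ u) (ρ ⟨$⟩ʳ v) ≡ adj G u v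
    adj-cases {u} {v} (yes u∈D) (yes v∈D) = trans (cong₂ (adj G) (on-D u∈D) (on-D v∈D)) (adj-pres u v)
    adj-cases {u} {v} (yes u∈D) (no v∉D)  =
      trans (cong₂ (adj G) (on-D u∈D) (off-D v∉D)) (separated u∈D v∉D (γ , γ-aut , refl) (inOrbit-refl G v))
    adj-cases {u} {v} (no u∉D)  (yes v∈D) =
      trans (cong₂ (adj G) (off-D u∉D) (on-D v∈D))
            (homogeneous-sym G (separated v∈D u∉D) (inOrbit-refl G u) (γ , γ-aut , refl))
    adj-cases {u} {v} (no u∉D)  (no v∉D)  = cong₂ (adj G) (off-D u∉D) (off-D v∉D)

    colour-cases : ∀ {v} → Dec (D v) → colour G (ρ ⟨$⟩ʳ v) ≡ colour G v
    colour-cases {v} (yes v∈D) = trans (cong (colour G) (on-D v∈D)) (colour-pres v)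
    colour-cases {v} (no v∉D)  = cong (colour G) (off-D v∉D)

  component-stable : ∀ {u x γ} → IsAut G γ → SameOrbitComponent G u x → SameOrbitComponent G u (γ ⟨$⟩ʳ x)
  component-stable {γ = γ} γ-aut u~x = u~x ◅◅ (inj₁ (γ , γ-aut , refl) ◅ ε)

  component-separated : ∀ {u x y} → SameOrbitComponent G u x → ¬ SameOrbitComponent G u y →
                        Homogeneous G x y
  component-separated {x = x} {y} u~x u≁y with orbitStep⊎homConnected G x y
  ... | inj₁ step = contradiction (u~x ◅◅ (step ◅ ε)) u≁y
  ... | inj₂ hom  = homConnected⇒homogeneous G hom

  module _ {r : ℕ} {Γs : Fin r → PermSet n} (dd : IsDisjointDirectDecomposition (IsAut G) Γs) where

    open IsDisjointDirectDecomposition dd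
    open Decomposition dd

    different-factors-homogeneous : ∀ {i j x y} → i ≢ j → InSupp (Γs i) x → InSupp (Γs j) y →
                                    Homogeneous G x y
    different-factors-homogeneous {i} {j} {x} {y} i≢j x∈suppᵢ y∈suppⱼ (φ , φ-aut , refl) (ψ , ψ-aut , refl)
      with acts-as-factor {φ} φ-aut x∈suppᵢ | acts-as-factor {ψ} ψ-aut y∈suppⱼ
    ... | g , g∈Γᵢ , φx≡gx | h , h∈Γⱼ , ψy≡hy = begin
      adj G (φ ⟨$⟩ʳ x) (ψ ⟨$⟩ʳ y)             ≡⟨ cong₂ (adj G) φx≡gx ψy≡hy ⟩
      adj G (g ⟨$⟩ʳ x) (h ⟨$⟩ʳ y)             ≡⟨ cong (adj G (g ⟨$⟩ʳ x)) g-fixes-hy ⟨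
      adj G (g ⟨$⟩ʳ x) (g ⟨$⟩ʳ (h ⟨$⟩ʳ y))   ≡⟨ proj₁ (factor-⊆ i g∈Γᵢ) x (h ⟨$⟩ʳ y) ⟩
      adj G x (h ⟨$⟩ʳ y)                       ≡⟨ cong (λ z → adj G z (h ⟨$⟩ʳ y)) h-fixes-x ⟨
      adj G (h ⟨$⟩ʳ x) (h ⟨$⟩ʳ y)             ≡⟨ proj₁ (factor-⊆ j h∈Γⱼ) x y ⟩
      adj G x y                                ∎
      where
      open ≡-Reasoning
      g-fixes-hy : g ⟨$⟩ʳ (h ⟨$⟩ʳ y) ≡ h ⟨$⟩ʳ y
      g-fixes-hy = fixes-other-supp i≢j (supp-image (factor-subgroup j) h∈Γⱼ y∈suppⱼ) g∈Γᵢ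
      h-fixes-x : h ⟨$⟩ʳ x ≡ x
      h-fixes-x = fixes-other-supp (i≢j ∘ sym) x∈suppᵢ h∈Γⱼ

    factor-restriction-closed : ∀ {i D} → Decidable D → (∀ {x y} → D x → ¬ D y → Homogeneous G x y) →
                                ∀ {γ ρ} → Γs i γ → IsRestriction D γ ρ → Γs i ρ
    factor-restriction-closed {i} D? separated {γ} {ρ} γ∈Γᵢ ρ-restr =
      supp⊆⇒factor (restriction-isAut D? separated {γ} {ρ} (factor-⊆ i γ∈Γᵢ) ρ-restr)
                   (λ ρw≢w → γ , γ∈Γᵢ , restriction-supp {γ = γ} {ρ} ρ-restr ρw≢w)

    orbitStep-preserves-supp : ∀ {i x y} → InSupp (Γs i) x → OrbitStep G x y → InSupp (Γs i) y
    orbitStep-preserves-supp x∈supp (inj₁ (φ , φ-aut , refl)) = supp-image-factor {φ} φ-aut x∈supp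
    orbitStep-preserves-supp {i} {x} {y} x∈supp (inj₂ (_ , ¬hom)) with inSuppAut? G y
    ... | no y-fixed = contradiction (homogeneous⇒homConnected G (fixed⇒homogeneous G y-fixed)) ¬hom
    ... | yes y∈supp with supp-factor y∈supp
    ...   | j , y∈suppⱼ with i ≟ j
    ...     | yes refl = y∈suppⱼ
    ...     | no i≢j   =
      contradiction (homogeneous⇒homConnected G (different-factors-homogeneous i≢j x∈supp y∈suppⱼ)) ¬hom

    component-preserves-supp : ∀ {i x y} → InSupp (Γs i) x → SameOrbitComponent G x y → InSupp (Γs i) y
    component-preserves-supp x∈supp ε             = x∈supp
    component-preserves-supp x∈supp (step ◅ steps) =
      component-preserves-supp (orbitStep-preserves-supp x∈supp step) steps

    disconnected⇒nontrivialDDD : ∀ {i u v} → InSupp (Γs i) u → InSupp (Γs i) v →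
                                 ¬ SameOrbitComponent G u v → HasNontrivialDDD (Γs i)
    disconnected⇒nontrivialDDD {i} {u} (σ , σ∈Γᵢ , σu≢u) (τ , τ∈Γᵢ , τv≢v) u≁v =
      splitting-nontrivial σ∈Γᵢ τ∈Γᵢ ε u≁v σu≢u τv≢v
      where
      C : Pred (Fin n) 0ℓ
      C = SameOrbitComponent G u

      C? : Decidable C
      C? = Reachability.star? (orbitStep? G) u

      open Splitting (factor-subgroup i) C? (λ {γ} γ∈Γᵢ → component-stable {γ = γ} (factor-⊆ i γ∈Γᵢ))
                     (factor-restriction-closed C? component-separated)
                     (factor-restriction-closed (∁? C?) λ x∉C ¬y∉C →
                        homogeneous-sym G (component-separated (decidable-stable (C? _) ¬y∉C) x∉C))

mainTheorem1 : ∀ {n : ℕ} (G : Graph n) {r : ℕ} (Γs : Fin r → PermSet n) →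
    IsFinestDDD (IsAut G) Γs →
    ∀ (u v : Fin n) → InSupp (IsAut G) u → InSupp (IsAut G) v →
    (∃[ i ] (InSupp (Γs i) u × InSupp (Γs i) v)) ⇔ SameOrbitComponent G u v
mainTheorem1 G Γs (dd , finest) u v u∈supp _ = mk⇔ same-factor⇒connected connected⇒same-factor
  where
  open Decomposition dd using (supp-factor)

  same-factor⇒connected : ∃[ i ] (InSupp (Γs i) u × InSupp (Γs i) v) → SameOrbitComponent G u v
  same-factor⇒connected (i , u∈suppᵢ , v∈suppᵢ) =
    decidable-stable (Reachability.star? (orbitStep? G) u v)
                     (finest i ∘ disconnected⇒nontrivialDDD G dd u∈suppᵢ v∈suppᵢ)

  connected⇒same-factor : SameOrbitComponent G u v → ∃[ i ] (InSupp (Γs i) u × InSupp (Γs i) v)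
  connected⇒same-factor u~v with supp-factor u∈supp
  ... | i , u∈suppᵢ = i , u∈suppᵢ , component-preserves-supp G dd u∈suppᵢ u~v
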